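{- Let $k$ be a positive integer and $\lambda\neq 1^k$ an integer partition of $k$, written $\lambda=(\lambda_1,\dots,\lambda_m,1^t)$ with $\lambda_m>1$ (here $1^t$ denotes $t$ parts equal to $1$). Let $s$ be an integer with $t\geqslant s$, and let $\mu$ be the weakly decreasing rearrangement of $(\lambda_1,\dots,\lambda_m,s,1^{t-s})$. If $s\geqslant\lambda_m$, then $\mu\prec\lambda$.
   Context: A set partition of a finite set is a set of nonempty pairwise disjoint blocks whose union is the set; its type is the integer partition of sorted block sizes. For set partitions of $[k]=\{1,\dots,k\}$, $\pi\vee\tau$ denotes their join in refinement order (finest set partition coarser than both). For integer partitions $\mu,\lambda$ of $k$, $\mu\preceq\lambda$ means there exist $\ell\ge0$ and set partitions $\pi_0,\dots,\pi_\ell$ of $[k]$ of type $\lambda$ with $\pi_0\vee\cdots\vee\pi_\ell$ of type $\mu$; this is a partial order, and $\mu\prec\lambda$ means $\mu\preceq\lambda$ and $\mu\neq\lambda$. -}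

module Defs where

open import Data.Nat using (ℕ; suc; _≥_; _>_; _≤?_)
open import Data.Nat.ListAction using (sum)
open import Data.Fin using (Fin) renaming (_≟_ to _≟ᶠ_)
open import Data.List using (List; []; _∷_; map; filter; length; allFin; replicate; _++_)
open import Data.List.Relation.Unary.All using (All)
open import Data.List.Relation.Unary.Linked using (Linked)
open import Data.List.Relation.Binary.Permutation.Propositional using (_↭_)
open import Data.Product using (Σ; _×_)
open import Relation.Binary.PropositionalEquality using (_≡_; _≢_)

IsIntPartition : List ℕ → Set
IsIntPartition ν = All (λ x → x > 0) ν × Linked _≥_ ν

-- A set partition of [k] = Fin k is represented by a labelling f : Fin k → Fin k;
-- its blocks are the nonempty fibres of f (i and j lie in the same block iff f i ≡ f j).
-- Every set partition of [k] arises this way (at most k blocks).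
SetPartLabel : ℕ → Set
SetPartLabel k = Fin k → Fin k

fibreSizes : ∀ {k} → SetPartLabel k → List ℕ
fibreSizes {k} f = map (λ c → length (filter (λ i → f i ≟ᶠ c) (allFin k))) (allFin k)

blockSizes : ∀ {k} → SetPartLabel k → List ℕ
blockSizes f = filter (λ n → 1 ≤? n) (fibreSizes f)

HasType : ∀ {k} → SetPartLabel k → List ℕ → Set
HasType f ν = Linked _≥_ ν × (ν ↭ blockSizes f)

-- JoinRel fs i j : i and j are in the same block of the join π_0 ∨ … ∨ π_ℓ,
-- i.e. the equivalence relation generated by the union of the block relations.
data JoinRel {k ℓ : ℕ} (fs : Fin (suc ℓ) → SetPartLabel k) : Fin k → Fin k → Set where
  step  : ∀ r i j → fs r i ≡ fs r j → JoinRel fs i j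
  trans : ∀ {i j l} → JoinRel fs i j → JoinRel fs j l → JoinRel fs i l

IsJoin : ∀ {k ℓ} → (Fin (suc ℓ) → SetPartLabel k) → SetPartLabel k → Set
IsJoin fs g = ∀ i j → (g i ≡ g j → JoinRel fs i j) × (JoinRel fs i j → g i ≡ g j)

_≼_ : List ℕ → List ℕ → Set
μ ≼ λ′ = Σ ℕ λ ℓ → Σ (Fin (suc ℓ) → SetPartLabel (sum λ′)) λ fs →
           (∀ r → HasType (fs r) λ′) ×
           Σ (SetPartLabel (sum λ′)) λ g → IsJoin fs g × HasType g μ

_≺_ : List ℕ → List ℕ → Set
μ ≺ λ′ = μ ≼ λ′ × μ ≢ λ′

mkPart : List ℕ → ℕ → List ℕ
mkPart ls t = ls ++ replicate t 1

module Submission where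

open import Defs
open import Data.Nat using (ℕ; zero; suc; _+_; _*_; _∸_; _≤_; _≥_; _>_; s≤s; z≤n; _≤?_)
open import Data.Nat.Properties using (*-identityʳ; <⇒≢; ≤-trans; ≤-refl; <⇒≤; <-trans; +-identityʳ; +-suc; +-comm; +-assoc; +-cancelʳ-≡; m≤n⇒∃[o]m+o≡n; m+[n∸m]≡n; suc-injective)
open import Data.Nat.ListAction using (sum)
open import Data.Nat.ListAction.Properties using (sum-++; sum-↭)
open import Data.Fin using (Fin; zero; suc; _↑ˡ_; _↑ʳ_; splitAt; cast; _≟_)
open import Data.Fin.Properties using (↑ˡ-injective; ↑ʳ-injective; splitAt-↑ˡ; splitAt-↑ʳ; cast-is-id)
open import Data.List using (List; []; _∷_; _++_; map; filter; length; tabulate; allFin; replicate; last; head)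
open import Data.List.Properties using (map-tabulate; tabulate-cong; map-cong; length-map; length-++; length-replicate; length-tabulate; filter-++; filter-≐; filter-all; filter-none; filter-accept)
open import Data.List.Relation.Unary.All as All using (All; []; _∷_)
open import Data.List.Relation.Unary.All.Properties as All using (tabulate⁺)
open import Data.List.Relation.Unary.Linked using (Linked; []; [-]; _∷_)
import Data.List.Relation.Unary.Linked.Properties as Linked
open import Data.Maybe using (just)
open import Data.Maybe.Relation.Binary.Connected using (Connected; just; just-nothing)
open import Data.List.Relation.Binary.Permutation.Propositional using (_↭_; module PermutationReasoning; ↭-refl; ↭-sym; ↭-trans; ↭-reflexive; ↭-prep; ↭-swap)
open import Data.List.Relation.Binary.Permutation.Propositional.Properties using (shift; shifts; ++-comm; ++⁺ˡ; ++⁺ʳ; All-resp-↭; ↭-length)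
open import Data.Sum using ([_,_]′)
open import Data.Product using (Σ; _,_; proj₁; proj₂)
open import Function using (_∘_; id)
open import Level using (0ℓ)
open import Relation.Nullary using (yes; no)
open import Relation.Unary using (Pred; Decidable)
open import Relation.Binary.PropositionalEquality as ≡ using (_≡_; _≢_; _≗_; refl; sym; cong; cong₂; subst; module ≡-Reasoning)

-- Write λ = ρ ∪ (l, 1^s) and μ = ρ ∪ (l, s), where l = λ_m satisfies 2 ≤ l ≤ s.
-- On the first l + s points take the set partitions having one block [0, l), or
-- one window [l + i, 2l + i) with 0 ≤ i ≤ s − l, and singletons otherwise; on the
-- remaining points lay out the parts of ρ, the same way each time. Since l ≥ 2,
-- consecutive windows overlap, so the join consists of [0, l), [l, l + s) and the
-- blocks of ρ: it has type μ. Finally μ ≠ λ because μ has fewer parts.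

↑ˡ≢↑ʳ : ∀ {a b} (x : Fin a) (y : Fin b) → x ↑ˡ b ≢ a ↑ʳ y
↑ˡ≢↑ʳ {a} {b} x y e with () ← ≡.trans (sym (splitAt-↑ˡ a x b)) (≡.trans (cong (splitAt a) e) (splitAt-↑ʳ a b y))

tabulate-+ : ∀ {A : Set} a {b} (g : Fin (a + b) → A) →
             tabulate g ≡ tabulate (g ∘ (_↑ˡ b)) ++ tabulate (g ∘ (a ↑ʳ_))
tabulate-+ zero    g = refl
tabulate-+ (suc a) g = cong (g zero ∷_) (tabulate-+ a (g ∘ suc))

replicate-+ : ∀ {A : Set} m n {x : A} → replicate (m + n) x ≡ replicate m x ++ replicate n x
replicate-+ zero    n = refl
replicate-+ (suc m) n = cong (_ ∷_) (replicate-+ m n)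

sum-replicate : ∀ n m → sum (replicate n m) ≡ n * m
sum-replicate zero    m = refl
sum-replicate (suc n) m = cong (m +_) (sum-replicate n m)

filter-map : ∀ {A B : Set} {P : Pred B 0ℓ} (P? : Decidable P) (g : A → B) xs →
             filter P? (map g xs) ≡ map g (filter (P? ∘ g) xs)
filter-map P? g []       = refl
filter-map P? g (x ∷ xs) with P? (g x)
... | yes _ = cong (g x ∷_) (filter-map P? g xs)
... | no _  = filter-map P? g xs

length-filter-tabulate : ∀ {A : Set} {P : Pred A 0ℓ} (P? : Decidable P) {n} (g : Fin n → A) →
                         length (filter P? (tabulate g)) ≡ length (filter (P? ∘ g) (allFin n))
length-filter-tabulate P? {n} g = begin
  length (filter P? (tabulate g))              ≡⟨ cong (length ∘ filter P?) (map-tabulate id g) ⟨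
  length (filter P? (map g (allFin n)))        ≡⟨ cong length (filter-map P? g (allFin n)) ⟩
  length (map g (filter (P? ∘ g) (allFin n)))  ≡⟨ length-map g (filter (P? ∘ g) (allFin n)) ⟩
  length (filter (P? ∘ g) (allFin n))          ∎
  where open ≡-Reasoning

length-filter-allFin-+ : ∀ a {b} {P : Pred (Fin (a + b)) 0ℓ} (P? : Decidable P) →
  length (filter P? (allFin (a + b))) ≡
  length (filter (P? ∘ (_↑ˡ b)) (allFin a)) + length (filter (P? ∘ (a ↑ʳ_)) (allFin b))
length-filter-allFin-+ a {b} P? = begin
  length (filter P? (allFin (a + b)))
    ≡⟨ cong (length ∘ filter P?) (tabulate-+ a id) ⟩
  length (filter P? (tabulate (_↑ˡ b) ++ tabulate (a ↑ʳ_)))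
    ≡⟨ cong length (filter-++ P? (tabulate (_↑ˡ b)) _) ⟩
  length (filter P? (tabulate (_↑ˡ b)) ++ filter P? (tabulate (a ↑ʳ_)))
    ≡⟨ length-++ (filter P? (tabulate (_↑ˡ b))) ⟩
  length (filter P? (tabulate (_↑ˡ b))) + length (filter P? (tabulate (a ↑ʳ_)))
    ≡⟨ cong₂ _+_ (length-filter-tabulate P? (_↑ˡ b)) (length-filter-tabulate P? (a ↑ʳ_)) ⟩
  length (filter (P? ∘ (_↑ˡ b)) (allFin a)) + length (filter (P? ∘ (a ↑ʳ_)) (allFin b)) ∎
  where open ≡-Reasoning

replicate-sorted : ∀ n {x} → Linked _≥_ (replicate n x)
replicate-sorted zero          = []
replicate-sorted (suc zero)    = [-]
replicate-sorted (suc (suc n)) = ≤-refl ∷ replicate-sorted (suc n)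

++-replicate-sorted : ∀ {xs x} t → Linked _≥_ xs → last xs ≡ just x → x ≥ 1 → Linked _≥_ (xs ++ replicate t 1)
++-replicate-sorted {xs} {x} t xs-sorted last≡x x≥1 =
  Linked.++⁺ xs-sorted (subst (λ m → Connected _≥_ m _) (sym last≡x) (junction t)) (replicate-sorted t)
  where
  junction : ∀ t → Connected _≥_ (just x) (head (replicate t 1))
  junction zero    = just-nothing
  junction (suc _) = just x≥1

last⇒↭ : ∀ {A : Set} (xs : List A) {x} → last xs ≡ just x → Σ (List A) λ ys → xs ↭ x ∷ ys
last⇒↭ (y ∷ [])     refl = [] , ↭-refl
last⇒↭ (y ∷ z ∷ zs) last≡x with ys , p ← last⇒↭ (z ∷ zs) last≡x =
  y ∷ ys , ↭-trans (↭-prep y p) (↭-swap y _ ↭-refl)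

-- Labellings

infixr 5 _⊕_

_⊕_ : ∀ {a b} → SetPartLabel a → SetPartLabel b → SetPartLabel (a + b)
_⊕_ {a} {b} f h i = [ (λ x → f x ↑ˡ b) , (λ y → a ↑ʳ h y) ]′ (splitAt a i)

block : ∀ {n} → SetPartLabel (suc n)
block _ = zero

discrete : ∀ {n} → SetPartLabel n
discrete i = i

transport : ∀ {m n} → m ≡ n → SetPartLabel m → SetPartLabel n
transport e f = cast e ∘ f ∘ cast (sym e)

layout : (ν : List ℕ) → All (_> 0) ν → SetPartLabel (sum ν)
layout []          []            = discrete
layout (suc n ∷ ν) (s≤s z≤n ∷ ps) = block {n} ⊕ layout ν ps

data SplitView (a : ℕ) {b : ℕ} : Fin (a + b) → Set where
  left  : (x : Fin a) → SplitView a (x ↑ˡ b)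
  right : (y : Fin b) → SplitView a (a ↑ʳ y)

splitView : ∀ a {b} (i : Fin (a + b)) → SplitView a i
splitView zero    i       = right i
splitView (suc a) zero    = left zero
splitView (suc a) (suc i) with splitView a i
... | left x  = left (suc x)
... | right y = right y

module _ {a b : ℕ} (f : SetPartLabel a) (h : SetPartLabel b) where

  ⊕-↑ˡ : ∀ x → (f ⊕ h) (x ↑ˡ b) ≡ f x ↑ˡ b
  ⊕-↑ˡ x rewrite splitAt-↑ˡ a x b = refl

  ⊕-↑ʳ : ∀ y → (f ⊕ h) (a ↑ʳ y) ≡ a ↑ʳ h y
  ⊕-↑ʳ y rewrite splitAt-↑ʳ a b y = refl

  ⊕-sameLabel-↑ˡ : ∀ {x y} → f x ≡ f y → (f ⊕ h) (x ↑ˡ b) ≡ (f ⊕ h) (y ↑ˡ b)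
  ⊕-sameLabel-↑ˡ {x} {y} e = ≡.trans (⊕-↑ˡ x) (≡.trans (cong (_↑ˡ b) e) (sym (⊕-↑ˡ y)))

  ⊕-sameLabel-↑ʳ : ∀ {x y} → h x ≡ h y → (f ⊕ h) (a ↑ʳ x) ≡ (f ⊕ h) (a ↑ʳ y)
  ⊕-sameLabel-↑ʳ {x} {y} e = ≡.trans (⊕-↑ʳ x) (≡.trans (cong (a ↑ʳ_) e) (sym (⊕-↑ʳ y)))

  ⊕-sameLabel-elim : (P : Fin (a + b) → Fin (a + b) → Set) →
                     (∀ {x y} → f x ≡ f y → P (x ↑ˡ b) (y ↑ˡ b)) →
                     (∀ {x y} → h x ≡ h y → P (a ↑ʳ x) (a ↑ʳ y)) →
                     ∀ {i j} → (f ⊕ h) i ≡ (f ⊕ h) j → P i j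
  ⊕-sameLabel-elim P onLeft onRight {i} {j} e with splitView a i | splitView a j
  ... | left x  | left y  = onLeft (↑ˡ-injective b _ _ (≡.trans (sym (⊕-↑ˡ x)) (≡.trans e (⊕-↑ˡ y))))
  ... | right x | right y = onRight (↑ʳ-injective a _ _ (≡.trans (sym (⊕-↑ʳ x)) (≡.trans e (⊕-↑ʳ y))))
  ... | left x  | right y with () ← ↑ˡ≢↑ʳ (f x) (h y) (≡.trans (sym (⊕-↑ˡ x)) (≡.trans e (⊕-↑ʳ y)))
  ... | right x | left y  with () ← ↑ˡ≢↑ʳ (f y) (h x) (≡.trans (sym (⊕-↑ˡ y)) (≡.trans (sym e) (⊕-↑ʳ x)))

-- Block sizes

fibreSize : ∀ {k} → SetPartLabel k → Fin k → ℕ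
fibreSize {k} f c = length (filter (λ i → f i ≟ c) (allFin k))

module _ {a b : ℕ} (f : SetPartLabel a) (h : SetPartLabel b) where

  fibreSize-⊕-↑ˡ : ∀ c → fibreSize (f ⊕ h) (c ↑ˡ b) ≡ fibreSize f c
  fibreSize-⊕-↑ˡ c = begin
    fibreSize (f ⊕ h) (c ↑ˡ b)
      ≡⟨ length-filter-allFin-+ a (λ i → (f ⊕ h) i ≟ c ↑ˡ b) ⟩
    length (filter (λ x → (f ⊕ h) (x ↑ˡ b) ≟ c ↑ˡ b) (allFin a)) +
    length (filter (λ y → (f ⊕ h) (a ↑ʳ y) ≟ c ↑ˡ b) (allFin b))
      ≡⟨ cong₂ _+_ (cong length (filter-≐ _ _ (to , from) (allFin a)))
                   (cong length (filter-none _ (tabulate⁺ λ y e → ↑ˡ≢↑ʳ c (h y) (sym (≡.trans (sym (⊕-↑ʳ f h y)) e))))) ⟩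
    fibreSize f c + 0
      ≡⟨ +-identityʳ _ ⟩
    fibreSize f c ∎
    where
    open ≡-Reasoning
    to : ∀ {x} → (f ⊕ h) (x ↑ˡ b) ≡ c ↑ˡ b → f x ≡ c
    to {x} e = ↑ˡ-injective b _ _ (≡.trans (sym (⊕-↑ˡ f h x)) e)
    from : ∀ {x} → f x ≡ c → (f ⊕ h) (x ↑ˡ b) ≡ c ↑ˡ b
    from {x} e = ≡.trans (⊕-↑ˡ f h x) (cong (_↑ˡ b) e)

  fibreSize-⊕-↑ʳ : ∀ c → fibreSize (f ⊕ h) (a ↑ʳ c) ≡ fibreSize h c
  fibreSize-⊕-↑ʳ c = begin
    fibreSize (f ⊕ h) (a ↑ʳ c)
      ≡⟨ length-filter-allFin-+ a (λ i → (f ⊕ h) i ≟ a ↑ʳ c) ⟩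
    length (filter (λ x → (f ⊕ h) (x ↑ˡ b) ≟ a ↑ʳ c) (allFin a)) +
    length (filter (λ y → (f ⊕ h) (a ↑ʳ y) ≟ a ↑ʳ c) (allFin b))
      ≡⟨ cong₂ _+_ (cong length (filter-none _ (tabulate⁺ λ x e → ↑ˡ≢↑ʳ (f x) c (≡.trans (sym (⊕-↑ˡ f h x)) e))))
                   (cong length (filter-≐ _ _ (to , from) (allFin b))) ⟩
    fibreSize h c ∎
    where
    open ≡-Reasoning
    to : ∀ {y} → (f ⊕ h) (a ↑ʳ y) ≡ a ↑ʳ c → h y ≡ c
    to {y} e = ↑ʳ-injective a _ _ (≡.trans (sym (⊕-↑ʳ f h y)) e)
    from : ∀ {y} → h y ≡ c → (f ⊕ h) (a ↑ʳ y) ≡ a ↑ʳ c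
    from {y} e = ≡.trans (⊕-↑ʳ f h y) (cong (a ↑ʳ_) e)

fibreSizes-tabulate : ∀ {k} (f : SetPartLabel k) → fibreSizes f ≡ tabulate (fibreSize f)
fibreSizes-tabulate f = map-tabulate id (fibreSize f)

fibreSizes-⊕ : ∀ {a b} (f : SetPartLabel a) (h : SetPartLabel b) →
               fibreSizes (f ⊕ h) ≡ fibreSizes f ++ fibreSizes h
fibreSizes-⊕ {a} {b} f h = begin
  fibreSizes (f ⊕ h)
    ≡⟨ fibreSizes-tabulate (f ⊕ h) ⟩
  tabulate (fibreSize (f ⊕ h))
    ≡⟨ tabulate-+ a (fibreSize (f ⊕ h)) ⟩
  tabulate (fibreSize (f ⊕ h) ∘ (_↑ˡ b)) ++ tabulate (fibreSize (f ⊕ h) ∘ (a ↑ʳ_))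
    ≡⟨ cong₂ _++_ (tabulate-cong (fibreSize-⊕-↑ˡ f h)) (tabulate-cong (fibreSize-⊕-↑ʳ f h)) ⟩
  tabulate (fibreSize f) ++ tabulate (fibreSize h)
    ≡⟨ cong₂ _++_ (fibreSizes-tabulate f) (fibreSizes-tabulate h) ⟨
  fibreSizes f ++ fibreSizes h ∎
  where open ≡-Reasoning

blockSizes-⊕ : ∀ {a b} (f : SetPartLabel a) (h : SetPartLabel b) →
               blockSizes (f ⊕ h) ≡ blockSizes f ++ blockSizes h
blockSizes-⊕ f h = ≡.trans (cong (filter (1 ≤?_)) (fibreSizes-⊕ f h)) (filter-++ (1 ≤?_) (fibreSizes f) (fibreSizes h))

blockSizes-cong : ∀ {k} {f h : SetPartLabel k} → f ≗ h → blockSizes f ≡ blockSizes h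
blockSizes-cong {k} {f} {h} f≗h = cong (filter (1 ≤?_)) (map-cong sameSize (allFin k))
  where
  sameSize : fibreSize f ≗ fibreSize h
  sameSize c = cong length (filter-≐ _ _ ((λ e → ≡.trans (sym (f≗h _)) e) , (λ e → ≡.trans (f≗h _) e)) (allFin k))

blockSizes-block : ∀ n → blockSizes (block {n}) ≡ suc n ∷ []
blockSizes-block n = begin
  blockSizes (block {n})
    ≡⟨ cong (filter (1 ≤?_)) (fibreSizes-tabulate (block {n})) ⟩
  filter (1 ≤?_) (fibreSize (block {n}) zero ∷ tabulate (fibreSize (block {n}) ∘ suc))
    ≡⟨ cong₂ (λ m ms → filter (1 ≤?_) (m ∷ ms)) wholeFibre (tabulate-cong emptyFibre) ⟩
  filter (1 ≤?_) (suc n ∷ tabulate {n = n} (λ _ → 0))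
    ≡⟨ filter-accept (1 ≤?_) {xs = tabulate {n = n} (λ _ → 0)} (s≤s z≤n) ⟩
  suc n ∷ filter (1 ≤?_) (tabulate {n = n} (λ _ → 0))
    ≡⟨ cong (suc n ∷_) (filter-none (1 ≤?_) {xs = tabulate {n = n} (λ _ → 0)} (tabulate⁺ λ _ ())) ⟩
  suc n ∷ [] ∎
  where
  open ≡-Reasoning
  wholeFibre : fibreSize (block {n}) zero ≡ suc n
  wholeFibre = ≡.trans (cong length (filter-all (λ i → block {n} i ≟ zero) {xs = allFin (suc n)} (tabulate⁺ {f = id} λ _ → refl)))
                       (length-tabulate {n = suc n} id)
  emptyFibre : ∀ c → fibreSize (block {n}) (suc c) ≡ 0
  emptyFibre c = cong length (filter-none (λ i → block {n} i ≟ suc c) {xs = allFin (suc n)} (tabulate⁺ {f = id} λ _ ()))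

blockSizes-discrete : ∀ n → blockSizes (discrete {n}) ≡ replicate n 1
blockSizes-discrete zero    = refl
blockSizes-discrete (suc n) = begin
  blockSizes (discrete {suc n})             ≡⟨ blockSizes-cong split ⟩
  blockSizes (block {0} ⊕ discrete {n})     ≡⟨ blockSizes-⊕ (block {0}) (discrete {n}) ⟩
  1 ∷ blockSizes (discrete {n})             ≡⟨ cong (1 ∷_) (blockSizes-discrete n) ⟩
  replicate (suc n) 1                       ∎
  where
  open ≡-Reasoning
  split : discrete ≗ block {0} ⊕ discrete {n}
  split zero    = refl
  split (suc i) = refl

blockSizes-transport : ∀ {m n} (e : m ≡ n) (f : SetPartLabel m) → blockSizes (transport e f) ≡ blockSizes f
blockSizes-transport refl f = blockSizes-cong λ i → ≡.trans (cast-is-id refl _) (cong f (cast-is-id refl i))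

blockSizes-layout : ∀ ν (ps : All (_> 0) ν) → blockSizes (layout ν ps) ≡ ν
blockSizes-layout []          []             = refl
blockSizes-layout (suc n ∷ ν) (s≤s z≤n ∷ ps) =
  ≡.trans (blockSizes-⊕ (block {n}) (layout ν ps)) (cong₂ _++_ (blockSizes-block n) (blockSizes-layout ν ps))

-- Joins

module _ {k ℓ : ℕ} {fs : Fin (suc ℓ) → SetPartLabel k} where

  JoinRel-refl : ∀ i → JoinRel fs i i
  JoinRel-refl i = step zero i i refl

  JoinRel-sym : ∀ {i j} → JoinRel fs i j → JoinRel fs j i
  JoinRel-sym (step r i j e) = step r j i (sym e)
  JoinRel-sym (trans p q)    = trans (JoinRel-sym q) (JoinRel-sym p)

  JoinRel⇒sameLabel : {g : SetPartLabel k} → (∀ r {i j} → fs r i ≡ fs r j → g i ≡ g j) →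
                      ∀ {i j} → JoinRel fs i j → g i ≡ g j
  JoinRel⇒sameLabel coarser (step r i j e) = coarser r e
  JoinRel⇒sameLabel coarser (trans p q)    = ≡.trans (JoinRel⇒sameLabel coarser p) (JoinRel⇒sameLabel coarser q)

  JoinRel-map : ∀ {k′ ℓ′} {gs : Fin (suc ℓ′) → SetPartLabel k′} (ρ : Fin (suc ℓ) → Fin (suc ℓ′)) (σ : Fin k → Fin k′) →
                (∀ r {i j} → fs r i ≡ fs r j → gs (ρ r) (σ i) ≡ gs (ρ r) (σ j)) →
                ∀ {i j} → JoinRel fs i j → JoinRel gs (σ i) (σ j)
  JoinRel-map ρ σ resp (step r i j e) = step (ρ r) (σ i) (σ j) (resp r e)
  JoinRel-map ρ σ resp (trans p q)    = trans (JoinRel-map ρ σ resp p) (JoinRel-map ρ σ resp q)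

IsConnected : ∀ {k ℓ} → (Fin (suc ℓ) → SetPartLabel k) → Set
IsConnected fs = ∀ i j → JoinRel fs i j

module _ {k ℓ : ℕ} {fs : Fin (suc ℓ) → SetPartLabel k} where

  connected-via : ∀ x → (∀ i → JoinRel fs x i) → IsConnected fs
  connected-via x reach i j = trans (JoinRel-sym (reach i)) (reach j)

  IsConnected⇒IsJoin-const : IsConnected fs → ∀ x → IsJoin fs (λ _ → x)
  IsConnected⇒IsJoin-const connected x i j = (λ _ → connected i j) , (λ _ → refl)

⊕-isJoin : ∀ {a b ℓ} {fs : Fin (suc ℓ) → SetPartLabel a} {hs : Fin (suc ℓ) → SetPartLabel b} {g h} →
           IsJoin fs g → IsJoin hs h → IsJoin (λ r → fs r ⊕ hs r) (g ⊕ h)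
⊕-isJoin {a} {b} {fs = fs} {hs} {g} {h} g-join h-join i j =
  ⊕-sameLabel-elim g h (JoinRel (λ r → fs r ⊕ hs r))
    (λ e → JoinRel-map id (_↑ˡ b) (λ r → ⊕-sameLabel-↑ˡ (fs r) (hs r)) (proj₁ (g-join _ _) e))
    (λ e → JoinRel-map id (a ↑ʳ_) (λ r → ⊕-sameLabel-↑ʳ (fs r) (hs r)) (proj₁ (h-join _ _) e)) ,
  JoinRel⇒sameLabel λ r → ⊕-sameLabel-elim (fs r) (hs r) (λ i j → (g ⊕ h) i ≡ (g ⊕ h) j)
    (λ e → ⊕-sameLabel-↑ˡ g h (proj₂ (g-join _ _) (step r _ _ e)))
    (λ e → ⊕-sameLabel-↑ʳ g h (proj₂ (h-join _ _) (step r _ _ e)))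

-- The construction

record ConnectedFamily (n : ℕ) (κ : List ℕ) : Set where
  field
    ℓ          : ℕ
    parts      : Fin (suc ℓ) → SetPartLabel n
    parts-type : ∀ r → κ ↭ blockSizes (parts r)
    connected  : IsConnected parts

-- Here lm = c + 2, and d + lm is written suc (d + suc c) so that adding a point
-- on the left is definitional.
-- The windows [i, i + lm) for i ≤ d, added from the left: the new window [0, lm)
-- meets the previous leftmost one in the point 1 because lm ≥ 2.
windows : ∀ c d → ConnectedFamily (suc (d + suc c)) (suc (suc c) ∷ replicate d 1)
windows c zero = record
  { ℓ          = 0
  ; parts      = λ _ → block
  ; parts-type = λ _ → ↭-reflexive (sym (blockSizes-block (suc c)))
  ; connected  = λ i j → step zero i j refl
  }
windows c (suc d) = record
  { ℓ          = suc ℓ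
  ; parts      = parts′
  ; parts-type = type′
  ; connected  = connected-via zero reach
  }
  where
  open ConnectedFamily (windows c d)

  reorder : suc (suc c) + suc d ≡ suc (suc d + suc c)
  reorder = cong (λ m → suc (suc m)) (≡.trans (+-comm c (suc d)) (sym (+-suc d c)))

  leftmost : SetPartLabel (suc (suc d + suc c))
  leftmost = transport reorder (block {suc c} ⊕ discrete {suc d})

  parts′ : Fin (suc (suc ℓ)) → SetPartLabel (suc (suc d + suc c))
  parts′ zero    = leftmost
  parts′ (suc r) = discrete {1} ⊕ parts r

  type′ : ∀ r → suc (suc c) ∷ replicate (suc d) 1 ↭ blockSizes (parts′ r)
  type′ zero = ↭-reflexive (sym (≡.trans (blockSizes-transport reorder (block {suc c} ⊕ discrete {suc d}))
                                (≡.trans (blockSizes-⊕ (block {suc c}) (discrete {suc d}))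
                                         (cong₂ _++_ (blockSizes-block (suc c)) (blockSizes-discrete (suc d))))))
  type′ (suc r) = ↭-trans (↭-trans (↭-swap _ _ ↭-refl) (↭-prep 1 (parts-type r)))
                          (↭-reflexive (sym (blockSizes-⊕ (discrete {1}) (parts r))))

  reach : ∀ i → JoinRel parts′ zero i
  reach zero    = JoinRel-refl zero
  reach (suc i) = trans (step zero zero (suc zero) refl)
                        (JoinRel-map suc suc (λ _ e → cong suc e) (connected zero i))

record JoinOfType (n : ℕ) (κ μ : List ℕ) : Set where
  field
    ℓ          : ℕ
    parts      : Fin (suc ℓ) → SetPartLabel n
    parts-type : ∀ r → κ ↭ blockSizes (parts r)
    join       : SetPartLabel n
    isJoin     : IsJoin parts join
    join-type  : μ ↭ blockSizes join

block+windows : ∀ c d → let lm = suc (suc c); s = suc (d + suc c) in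
                   JoinOfType (lm + s) (lm ∷ replicate s 1) (lm ∷ s ∷ [])
block+windows c d = record
  { ℓ          = suc ℓ
  ; parts      = λ r → onBlock r ⊕ onRest r
  ; parts-type = type
  ; join       = block {suc c} ⊕ block {d + suc c}
  ; isJoin     = ⊕-isJoin (IsConnected⇒IsJoin-const (λ i j → step zero i j refl) zero)
                          (IsConnected⇒IsJoin-const (λ i j → JoinRel-map suc id (λ _ e → e) (connected i j)) zero)
  ; join-type  = ↭-reflexive (sym (≡.trans (blockSizes-⊕ (block {suc c}) (block {d + suc c}))
                                           (cong₂ _++_ (blockSizes-block (suc c)) (blockSizes-block (d + suc c)))))
  }
  where
  open ConnectedFamily (windows c d)
  lm = suc (suc c)
  s  = suc (d + suc c)

  onBlock : Fin (suc (suc ℓ)) → SetPartLabel lm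
  onBlock zero    = block
  onBlock (suc _) = discrete

  onRest : Fin (suc (suc ℓ)) → SetPartLabel s
  onRest zero    = discrete
  onRest (suc r) = parts r

  type : ∀ r → lm ∷ replicate s 1 ↭ blockSizes (onBlock r ⊕ onRest r)
  type zero    = ↭-reflexive (sym (≡.trans (blockSizes-⊕ (block {suc c}) (discrete {s}))
                                           (cong₂ _++_ (blockSizes-block (suc c)) (blockSizes-discrete s))))
  type (suc r) = begin
    lm ∷ replicate s 1                     ≡⟨ cong (λ m → lm ∷ replicate m 1) (+-suc d (suc c)) ⟨
    lm ∷ replicate (d + lm) 1              ≡⟨ cong (lm ∷_) (replicate-+ d lm) ⟩
    lm ∷ replicate d 1 ++ replicate lm 1   ↭⟨ ↭-prep lm (++-comm (replicate d 1) (replicate lm 1)) ⟩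
    lm ∷ replicate lm 1 ++ replicate d 1   ↭⟨ shift lm (replicate lm 1) (replicate d 1) ⟨
    replicate lm 1 ++ lm ∷ replicate d 1   ↭⟨ ++⁺ˡ (replicate lm 1) (parts-type r) ⟩
    replicate lm 1 ++ blockSizes (parts r)
      ≡⟨ cong (_++ blockSizes (parts r)) (blockSizes-discrete lm) ⟨
    blockSizes (discrete {lm}) ++ blockSizes (parts r)
      ≡⟨ blockSizes-⊕ (discrete {lm}) (parts r) ⟨
    blockSizes (onBlock (suc r) ⊕ onRest (suc r)) ∎
    where open PermutationReasoning

block+singletons : ∀ {lm s} → 2 ≤ lm → lm ≤ s →
                              JoinOfType (lm + s) (lm ∷ replicate s 1) (lm ∷ s ∷ [])
block+singletons {suc (suc c)} (s≤s (s≤s z≤n)) lm≤s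
  with d , refl ← m≤n⇒∃[o]m+o≡n lm≤s
  = subst (λ s → JoinOfType (suc (suc c) + s) (suc (suc c) ∷ replicate s 1) (suc (suc c) ∷ s ∷ []))
          (cong suc (≡.trans (+-suc d c) (cong suc (+-comm d c))))
          (block+windows c d)

JoinOfType-++ : ∀ {n κ μ} → JoinOfType n κ μ → ∀ ρ → All (_> 0) ρ →
                JoinOfType (n + sum ρ) (κ ++ ρ) (μ ++ ρ)
JoinOfType-++ J ρ ρ>0 = record
  { ℓ          = ℓ
  ; parts      = λ r → parts r ⊕ L
  ; parts-type = λ r → extend (parts r) (parts-type r)
  ; join       = join ⊕ L
  ; isJoin     = ⊕-isJoin isJoin λ i j → step zero i j , JoinRel⇒sameLabel (λ _ e → e)
  ; join-type  = extend join join-type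
  }
  where
  open JoinOfType J
  L = layout ρ ρ>0
  extend : ∀ {ν} f → ν ↭ blockSizes f → ν ++ ρ ↭ blockSizes (f ⊕ L)
  extend f ν↭ = ↭-trans (++⁺ʳ ρ ν↭) (↭-reflexive (sym (≡.trans (blockSizes-⊕ f L) (cong (blockSizes f ++_) (blockSizes-layout ρ ρ>0)))))

JoinOfType-resp-↭ : ∀ {n κ κ′ μ μ′} → κ ↭ κ′ → μ ↭ μ′ → JoinOfType n κ μ → JoinOfType n κ′ μ′
JoinOfType-resp-↭ κ↭ μ↭ J = record
  { ℓ          = ℓ
  ; parts      = parts
  ; parts-type = λ r → ↭-trans (↭-sym κ↭) (parts-type r)
  ; join       = join
  ; isJoin     = isJoin
  ; join-type  = ↭-trans (↭-sym μ↭) join-type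
  }
  where open JoinOfType J

JoinOfType⇒≼ : ∀ {κ μ} → JoinOfType (sum κ) κ μ → Linked _≥_ κ → Linked _≥_ μ → μ ≼ κ
JoinOfType⇒≼ J κ-sorted μ-sorted =
  ℓ , parts , (λ r → κ-sorted , parts-type r) , join , isJoin , μ-sorted , join-type
  where open JoinOfType J

block+singletons-≺ : ∀ {κ μ} lm s ρ → 2 ≤ lm → lm ≤ s → All (_> 0) ρ →
                     Linked _≥_ κ → κ ↭ lm ∷ replicate s 1 ++ ρ →
                     Linked _≥_ μ → μ ↭ lm ∷ s ∷ ρ → μ ≺ κ
block+singletons-≺ {κ} {μ} lm s ρ 2≤lm lm≤s ρ>0 κ-sorted κ↭ μ-sorted μ↭ =
  JoinOfType⇒≼ (subst (λ n → JoinOfType n κ μ) size J) κ-sorted μ-sorted , μ≢κ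
  where
  J : JoinOfType (lm + s + sum ρ) κ μ
  J = JoinOfType-resp-↭ (↭-sym κ↭) (↭-sym μ↭) (JoinOfType-++ (block+singletons 2≤lm lm≤s) ρ ρ>0)

  size : lm + s + sum ρ ≡ sum κ
  size = begin
    lm + s + sum ρ                      ≡⟨ +-assoc lm s (sum ρ) ⟩
    lm + (s + sum ρ)                    ≡⟨ cong (λ m → lm + (m + sum ρ)) (≡.trans (sum-replicate s 1) (*-identityʳ s)) ⟨
    lm + (sum (replicate s 1) + sum ρ)  ≡⟨ cong (lm +_) (sum-++ (replicate s 1) ρ) ⟨
    sum (lm ∷ replicate s 1 ++ ρ)       ≡⟨ sum-↭ κ↭ ⟨
    sum κ                               ∎
    where open ≡-Reasoning

  μ≢κ : μ ≢ κ
  μ≢κ μ≡κ = <⇒≢ (≤-trans 2≤lm lm≤s) (sym (+-cancelʳ-≡ (length ρ) s 1 (suc-injective partCount)))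
    where
    partCount : suc (s + length ρ) ≡ suc (suc (length ρ))
    partCount = begin
      suc (s + length ρ)                      ≡⟨ cong (λ m → suc (m + length ρ)) (length-replicate s) ⟨
      suc (length (replicate s 1) + length ρ) ≡⟨ cong suc (length-++ (replicate s 1)) ⟨
      length (lm ∷ replicate s 1 ++ ρ)        ≡⟨ ↭-length κ↭ ⟨
      length κ                                ≡⟨ cong length μ≡κ ⟨
      length μ                                ≡⟨ ↭-length μ↭ ⟩
      suc (suc (length ρ))                    ∎
      where open ≡-Reasoning

lemma3p6 : (ls : List ℕ) (lm t s : ℕ) →
    ls ≢ [] → Linked _≥_ ls → All (λ x → x > 1) ls → last ls ≡ just lm →
    t ≥ s → s ≥ lm →
    (μ : List ℕ) → Linked _≥_ μ → μ ↭ (ls ++ s ∷ replicate (t ∸ s) 1) →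
    μ ≺ mkPart ls t
-- The hypothesis ls ≢ [] is implied by last ls ≡ just lm.
lemma3p6 ls lm t s _ ls-sorted ls>1 last≡lm t≥s s≥lm μ μ-sorted μ↭
  with rest , ls↭ ← last⇒↭ ls last≡lm
  with lm>1 ∷ rest>1 ← All-resp-↭ ls↭ ls>1 =
  block+singletons-≺ lm s ρ lm>1 s≥lm ρ>0 (++-replicate-sorted t ls-sorted last≡lm (<⇒≤ lm>1)) λ↭ μ-sorted μ↭′
  where
  u = t ∸ s
  ρ = rest ++ replicate u 1

  ρ>0 : All (_> 0) ρ
  ρ>0 = All.++⁺ (All.map (<-trans (s≤s z≤n)) rest>1) (All.replicate⁺ u (s≤s z≤n))

  λ↭ : mkPart ls t ↭ lm ∷ replicate s 1 ++ ρ
  λ↭ = begin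
    ls ++ replicate t 1                         ↭⟨ ++⁺ʳ (replicate t 1) ls↭ ⟩
    lm ∷ rest ++ replicate t 1                  ≡⟨ cong (λ n → lm ∷ rest ++ replicate n 1) (m+[n∸m]≡n t≥s) ⟨
    lm ∷ rest ++ replicate (s + u) 1            ≡⟨ cong (λ xs → lm ∷ rest ++ xs) (replicate-+ s u) ⟩
    lm ∷ rest ++ replicate s 1 ++ replicate u 1 ↭⟨ ↭-prep lm (shifts rest (replicate s 1)) ⟩
    lm ∷ replicate s 1 ++ ρ                     ∎
    where open PermutationReasoning

  μ↭′ : μ ↭ lm ∷ s ∷ ρ
  μ↭′ = ↭-trans μ↭ (↭-trans (++⁺ʳ (s ∷ replicate u 1) ls↭) (↭-prep lm (shift s rest (replicate u 1))))
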